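{- Let $G$ be a non-empty gapset of genus $g$ and depth $q$ which is not the hyperelliptic gapset $(2\mathbb N+1)\cap[1,2g-1]$. Then $1\le q\le\left\lceil\frac{2g}{3}\right\rceil$.
   Context: A gapset is a finite set $G\subset\mathbb N$ (positive integers) such that whenever $z\in G$ and $z=x+y$ with $x,y\in\mathbb N$, then $x\in G$ or $y\in G$. Its genus is $\#G$, its multiplicity is $m(G)=\min\{s\in\mathbb N_0\setminus G: s\ne0\}$, its conductor is $c(G)=\min\{s\in\mathbb N_0: s+n\notin G\ \forall n\in\mathbb N_0\}$, and its depth is $\lceil c(G)/m(G)\rceil$. The hyperelliptic gapset of genus $g$ is the set of odd integers in $[1,2g-1]$. -}

module Defs where

open import Data.Nat using (ℕ; zero; suc; _+_; _*_; _∸_; _≤_; _<_; NonZero)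
open import Data.Nat.DivMod using (_/_)
open import Data.List using (List; length)
open import Data.List.Membership.Propositional using (_∈_; _∉_)
open import Data.List.Relation.Unary.Unique.Propositional using (Unique)
open import Data.Product using (_×_; ∃)
open import Data.Sum using (_⊎_)
open import Function.Bundles using (_⇔_)

-- A finite subset of ℕ is represented by a duplicate-free list.
-- Gapset: finite set of positive integers, closed under "splitting".
record IsGapset (G : List ℕ) : Set where
  field
    unique   : Unique G
    positive : ∀ {z} → z ∈ G → 1 ≤ z
    split    : ∀ x y → 1 ≤ x → 1 ≤ y → (x + y) ∈ G → x ∈ G ⊎ y ∈ G

genus : List ℕ → ℕ
genus G = length G

IsMultiplicity : List ℕ → ℕ → Set
IsMultiplicity G m = 1 ≤ m × m ∉ G × (∀ s → 1 ≤ s → s < m → s ∈ G)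

IsConductor : List ℕ → ℕ → Set
IsConductor G c = (∀ n → (c + n) ∉ G) × (∀ s → s < c → ∃ λ n → (s + n) ∈ G)

⌈_/_⌉ : (a b : ℕ) → .{{NonZero b}} → ℕ
⌈ a / b ⌉ = (a + b ∸ 1) / b

Odd : ℕ → Set
Odd x = ∃ λ k → x ≡ 1 + 2 * k
  where open import Relation.Binary.PropositionalEquality using (_≡_)

IsHyperelliptic : ℕ → List ℕ → Set
IsHyperelliptic g G = ∀ x → (x ∈ G) ⇔ (Odd x × x ≤ 2 * g ∸ 1)

{-# OPTIONS --safe #-}
module Submission where

-- Let f = c − 1 be the largest gap. For 0 ≤ z ≤ f, splitting f = z + (f − z) puts z or f − z
-- in G, so the c numbers 0, …, f are covered by G and f − G, whence c ≤ 2g. A nonempty gapset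
-- contains 1, so m ≥ 2. If m = 2, splitting off 2 repeatedly shows that G holds no even number
-- and every odd number below f; then G is the set of odd numbers up to f, and c ≤ 2g forces
-- f = 2g − 1, so G is hyperelliptic. Hence m ≥ 3, and c ≤ 2g ≤ 3⌈2g/3⌉ ≤ m⌈2g/3⌉.

open import Defs
open import Data.Nat using (ℕ; zero; suc; _+_; _*_; _∸_; _≤_; _≤′_; ≤′-refl; ≤′-step; z≤n; s≤s; s≤s⁻¹; NonZero)
open import Data.Nat.Properties
open import Data.Nat.DivMod using (_%_; m≡m%n+[m/n]*n; m%n<n; m<n*o⇒m/o<n; m≥n⇒m/n>0)
open import Data.List using (List; []; _∷_; length; _++_; map; upTo)
open import Data.List.Properties using (length-++; length-map; length-upTo)
open import Data.List.Membership.Propositional using (_∈_; _∉_)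
open import Data.List.Membership.Propositional.Properties
  using (∈-++⁺ˡ; ∈-++⁺ʳ; ∈-++⁻; ∈-∃++; ∈-map⁺; ∈-upTo⁺; ∈-upTo⁻)
open import Data.List.Relation.Unary.Any using (here; there)
open import Data.List.Relation.Unary.All as All using ()
open import Data.List.Relation.Unary.AllPairs using ([]; _∷_)
open import Data.List.Relation.Unary.Unique.Propositional using (Unique)
open import Data.List.Relation.Binary.Subset.Propositional using (_⊆_)
open import Data.List.Relation.Unary.Unique.Propositional.Properties using (upTo⁺)
open import Data.Product using (_×_; _,_; ∃)
open import Data.Sum using (_⊎_; inj₁; inj₂)
open import Data.Empty using (⊥-elim)
open import Function using (_∘_; id)
open import Function.Bundles using (mk⇔)
open import Relation.Nullary using (¬_)
open import Relation.Binary.PropositionalEquality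

⊆-length : ∀ {a} {A : Set a} {xs ys : List A} → Unique xs → xs ⊆ ys → length xs ≤ length ys
⊆-length {xs = []} _ _ = z≤n
⊆-length {xs = x ∷ xs} (x∉xs ∷ unique) xs⊆ys with us , vs , refl ← ∈-∃++ (xs⊆ys (here refl)) =
  begin
    suc (length xs)              ≤⟨ s≤s (⊆-length unique xs⊆us++vs) ⟩
    suc (length (us ++ vs))      ≡⟨ cong suc (length-++ us) ⟩
    suc (length us + length vs)  ≡⟨ +-suc (length us) (length vs) ⟨
    length us + length (x ∷ vs)  ≡⟨ length-++ us ⟨
    length (us ++ x ∷ vs)        ∎
  where
  open ≤-Reasoning
  xs⊆us++vs : xs ⊆ us ++ vs
  xs⊆us++vs z∈xs with ∈-++⁻ us (xs⊆ys (there z∈xs))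
  ... | inj₁ z∈us         = ∈-++⁺ˡ z∈us
  ... | inj₂ (here z≡x)   = ⊥-elim (All.lookup x∉xs z∈xs (sym z≡x))
  ... | inj₂ (there z∈vs) = ∈-++⁺ʳ us z∈vs

⌈/⌉-positive : ∀ a b .{{_ : NonZero b}} → 1 ≤ a → 1 ≤ ⌈ a / b ⌉
⌈/⌉-positive (suc a) b _ = m≥n⇒m/n>0 (m≤n+m b a)

≤⌈/⌉* : ∀ a b .{{_ : NonZero b}} → a ≤ ⌈ a / b ⌉ * b
≤⌈/⌉* a b@(suc b-1) = +-cancelʳ-≤ b-1 a (⌈ a / b ⌉ * b) (begin
  a + b-1                            ≡⟨ +-∸-assoc a (s≤s z≤n) ⟨
  a + b ∸ 1                          ≡⟨ m≡m%n+[m/n]*n (a + b ∸ 1) b ⟩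
  (a + b ∸ 1) % b + ⌈ a / b ⌉ * b    ≤⟨ +-monoˡ-≤ (⌈ a / b ⌉ * b) (s≤s⁻¹ (m%n<n (a + b ∸ 1) b)) ⟩
  b-1 + ⌈ a / b ⌉ * b                ≡⟨ +-comm b-1 (⌈ a / b ⌉ * b) ⟩
  ⌈ a / b ⌉ * b + b-1                ∎)
  where open ≤-Reasoning

⌈/⌉≤ : ∀ a b q .{{_ : NonZero b}} → a ≤ q * b → ⌈ a / b ⌉ ≤ q
⌈/⌉≤ a b@(suc b-1) q a≤qb = s≤s⁻¹ (m<n*o⇒m/o<n (begin-strict
  a + b ∸ 1   ≡⟨ +-∸-assoc a (s≤s z≤n) ⟩
  a + b-1     <⟨ +-monoʳ-< a (n<1+n b-1) ⟩
  a + b       ≤⟨ +-monoˡ-≤ b a≤qb ⟩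
  q * b + b   ≡⟨ +-comm (q * b) b ⟩
  suc q * b   ∎))
  where open ≤-Reasoning

even-or-odd : ∀ n → (∃ λ k → n ≡ 2 * k) ⊎ Odd n
even-or-odd zero = inj₁ (0 , refl)
even-or-odd (suc n) with even-or-odd n
... | inj₁ (k , refl) = inj₂ (k , refl)
... | inj₂ (k , refl) = inj₁ (suc k , sym (*-suc 2 k))

module _ {G : List ℕ} (gapset : IsGapset G) where
  open IsGapset gapset

  split₀ : ∀ x y → x + y ∈ G → x ∈ G ⊎ y ∈ G
  split₀ zero    y       y∈G   = inj₂ y∈G
  split₀ (suc x) zero    x+0∈G = inj₁ (subst (_∈ G) (+-identityʳ (suc x)) x+0∈G)
  split₀ (suc x) (suc y) x+y∈G = split (suc x) (suc y) (s≤s z≤n) (s≤s z≤n) x+y∈G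

  ∈⇒1∈ : ∀ {z} → z ∈ G → 1 ∈ G
  ∈⇒1∈ {zero}  0∈G with () ← positive 0∈G
  ∈⇒1∈ {suc z} z+1∈G with split₀ 1 z z+1∈G
  ... | inj₁ 1∈G = 1∈G
  ... | inj₂ z∈G = ∈⇒1∈ z∈G

  multiplicity≥2 : ∀ {z m} → z ∈ G → IsMultiplicity G m → 2 ≤ m
  multiplicity≥2 {m = zero}        _   (() , _)
  multiplicity≥2 {m = suc zero}    z∈G (_ , 1∉G , _) = ⊥-elim (1∉G (∈⇒1∈ z∈G))
  multiplicity≥2 {m = suc (suc m)} _   _             = s≤s (s≤s z≤n)

  conductor-positive : ∀ {z c} → z ∈ G → IsConductor G c → 1 ≤ c
  conductor-positive {z} {zero}    z∈G (c+n∉G , _) = ⊥-elim (c+n∉G z z∈G)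
  conductor-positive {c = suc c} _   _            = s≤s z≤n

  frobenius∈ : ∀ {f} → IsConductor G (suc f) → f ∈ G
  frobenius∈ {f} (c+n∉G , c-minimal) with c-minimal f ≤-refl
  ... | zero  , f+0∈G   = subst (_∈ G) (+-identityʳ f) f+0∈G
  ... | suc n , f+n+1∈G = ⊥-elim (c+n∉G n (subst (_∈ G) (+-suc f n) f+n+1∈G))

  ≤frobenius : ∀ {f x} → IsConductor G (suc f) → x ∈ G → x ≤ f
  ≤frobenius {f} {x} (c+n∉G , _) x∈G with ≤-<-connex x f
  ... | inj₁ x≤f = x≤f
  ... | inj₂ f<x = ⊥-elim (c+n∉G (x ∸ suc f) (subst (_∈ G) (sym (m+[n∸m]≡n f<x)) x∈G))

  conductor≤2*genus : ∀ {c} → IsConductor G c → c ≤ 2 * genus G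
  conductor≤2*genus {zero}  _    = z≤n
  conductor≤2*genus {suc f} cond = begin
    suc f                            ≡⟨ length-upTo (suc f) ⟨
    length (upTo (suc f))            ≤⟨ ⊆-length (upTo⁺ (suc f)) cover ⟩
    length (G ++ map (f ∸_) G)       ≡⟨ length-++ G ⟩
    genus G + length (map (f ∸_) G)  ≡⟨ cong (genus G +_) (length-map (f ∸_) G) ⟩
    genus G + genus G                ≡⟨ cong (genus G +_) (+-identityʳ (genus G)) ⟨
    2 * genus G                      ∎
    where
    open ≤-Reasoning
    cover : upTo (suc f) ⊆ G ++ map (f ∸_) G
    cover {z} z∈ with s≤s⁻¹ (∈-upTo⁻ z∈)
    ... | z≤f with split₀ z (f ∸ z) (subst (_∈ G) (sym (m+[n∸m]≡n z≤f)) (frobenius∈ cond))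
    ... | inj₁ z∈G   = ∈-++⁺ˡ z∈G
    ... | inj₂ f∸z∈G = ∈-++⁺ʳ G (subst (_∈ map (f ∸_) G) (m∸[m∸n]≡n z≤f) (∈-map⁺ (f ∸_) f∸z∈G))

  module _ (2∉G : 2 ∉ G) where

    +2∈⇒∈ : ∀ {x} → 1 ≤ x → 2 + x ∈ G → x ∈ G
    +2∈⇒∈ {x} 1≤x x+2∈G with split 2 x (s≤s z≤n) 1≤x x+2∈G
    ... | inj₁ 2∈G = ⊥-elim (2∉G 2∈G)
    ... | inj₂ x∈G = x∈G

    even∉ : ∀ k → 2 * suc k ∉ G
    even∉ zero    = 2∉G
    even∉ (suc k) = even∉ k ∘ +2∈⇒∈ (s≤s z≤n) ∘ subst (_∈ G) (*-suc 2 (suc k))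

    ∈⇒odd : ∀ {x} → x ∈ G → Odd x
    ∈⇒odd {x} x∈G with even-or-odd x
    ... | inj₂ odd           = odd
    ... | inj₁ (zero  , refl) with () ← positive x∈G
    ... | inj₁ (suc k , refl) = ⊥-elim (even∉ k x∈G)

    odd∈-down : ∀ {j k} → j ≤′ k → 1 + 2 * k ∈ G → 1 + 2 * j ∈ G
    odd∈-down ≤′-refl = id
    odd∈-down {k = suc k} (≤′-step j≤′k) =
      odd∈-down j≤′k ∘ +2∈⇒∈ (s≤s z≤n) ∘ subst (_∈ G) (cong suc (*-suc 2 k))

    2∉⇒hyperelliptic : ∀ {f} → IsConductor G (suc f) → IsHyperelliptic (genus G) G
    2∉⇒hyperelliptic cond with k , refl ← ∈⇒odd (frobenius∈ cond) = λ x → mk⇔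
      (λ x∈G → ∈⇒odd x∈G , subst (x ≤_) f≡2g∸1 (≤frobenius cond x∈G))
      (λ { ((j , refl) , x≤2g∸1) →
        odd∈-down {j} (≤⇒≤′ (index-mono {j} (subst (1 + 2 * j ≤_) (sym f≡2g∸1) x≤2g∸1))) (frobenius∈ cond) })
      where
      index-mono : ∀ {j} → 1 + 2 * j ≤ 1 + 2 * k → j ≤ k
      index-mono = *-cancelˡ-≤ 2 ∘ s≤s⁻¹

      odds : List ℕ
      odds = map (λ j → 1 + 2 * j) (upTo (suc k))

      G⊆odds : G ⊆ odds
      G⊆odds x∈G with j , refl ← ∈⇒odd x∈G =
        ∈-map⁺ (λ j → 1 + 2 * j) (∈-upTo⁺ (s≤s (index-mono {j} (≤frobenius cond x∈G))))

      genus≡ : genus G ≡ suc k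
      genus≡ = ≤-antisym
        (begin
          genus G                 ≤⟨ ⊆-length unique G⊆odds ⟩
          length odds             ≡⟨ length-map (λ j → 1 + 2 * j) (upTo (suc k)) ⟩
          length (upTo (suc k))   ≡⟨ length-upTo (suc k) ⟩
          suc k                   ∎)
        (*-cancelˡ-≤ 2 (subst (_≤ 2 * genus G) (sym (*-suc 2 k)) (conductor≤2*genus cond)))
        where open ≤-Reasoning

      f≡2g∸1 : 1 + 2 * k ≡ 2 * genus G ∸ 1
      f≡2g∸1 = begin
        1 + 2 * k           ≡⟨ cong (_∸ 1) (*-suc 2 k) ⟨
        2 * suc k ∸ 1       ≡⟨ cong (λ g → 2 * g ∸ 1) genus≡ ⟨
        2 * genus G ∸ 1     ∎
        where open ≡-Reasoning

  multiplicity-2⇒hyperelliptic : ∀ {c} → IsMultiplicity G 2 → IsConductor G c → IsHyperelliptic (genus G) G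
  multiplicity-2⇒hyperelliptic {zero} (_ , _ , below-m∈G) cond
    with () ← conductor-positive (below-m∈G 1 (s≤s z≤n) (s≤s (s≤s z≤n))) cond
  multiplicity-2⇒hyperelliptic {suc f} (_ , 2∉G , _) cond = 2∉⇒hyperelliptic 2∉G cond

proposition6p4 : (G : List ℕ) → IsGapset G → 1 ≤ genus G → ¬ IsHyperelliptic (genus G) G →
    (m c : ℕ) → IsMultiplicity G m → IsConductor G c → .{{_ : NonZero m}} →
    1 ≤ ⌈ c / m ⌉ × ⌈ c / m ⌉ ≤ ⌈ 2 * genus G / 3 ⌉
proposition6p4 []         _      ()
proposition6p4 G@(_ ∷ _) gapset _ ¬hyperelliptic m c mult cond =
  ⌈/⌉-positive c m (conductor-positive gapset (here refl) cond) ,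
  ⌈/⌉≤ c m q (begin
    c            ≤⟨ conductor≤2*genus gapset cond ⟩
    2 * genus G  ≤⟨ ≤⌈/⌉* (2 * genus G) 3 ⟩
    q * 3        ≤⟨ *-monoʳ-≤ q 3≤m ⟩
    q * m        ∎)
  where
  open ≤-Reasoning
  q : ℕ
  q = ⌈ 2 * genus G / 3 ⌉
  3≤m : 3 ≤ m
  3≤m = ≤∧≢⇒< (multiplicity≥2 gapset (here refl) mult) λ { refl →
    ¬hyperelliptic (multiplicity-2⇒hyperelliptic gapset mult cond) }
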